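{- For every positive integer $k\le 3$, the path $P_k$ defines none of the graphs $P_3$, $K_3$, $K_{1,3}$, $2K_2$, $P_4$, $C_4$, $F_1$, $K_4-e$, $P_2\cup P_3$, $F_2$, $B_1$, $P_5$, $S(2,1)$, $S(2,2)$.
   Context: For a graph $G$ with vertex set $V$, a set $S\subseteq V$ is a dominating set if every vertex of $V\setminus S$ is adjacent to a vertex of $S$. Two disjoint sets $V_1,V_2\subseteq V$ form a coalition in $G$ if neither is a dominating set of $G$ but $V_1\cup V_2$ is. A coalition partition of $G$ is a partition $\Psi=\{V_1,\ldots,V_k\}$ of $V$ such that every $V_i\in\Psi$ is either a dominating set of $G$ with $|V_i|=1$, or is not a dominating set and forms a coalition with some $V_j\in\Psi$. Given a coalition partition $\Psi$ of $G$, the coalition graph $\mathrm{CG}(G,\Psi)$ has vertex set $\Psi$, two members adjacent iff they form a coalition in $G$. A path $P_k$ (on $k$ vertices) defines a graph $H$ if there is a coalition partition $\Psi$ of $P_k$ with $\mathrm{CG}(P_k,\Psi)\cong H$. Graphs: $F_1$ is a triangle with one pendant edge attached; $F_2$ is a $4$-cycle with one pendant edge attached; $B_1$ (the bull) is a triangle with pendant edges attached at two distinct vertices; $S(r,s)$ is the double star: a tree with exactly two adjacent non-leaf vertices having $r$ and $s$ leaf neighbors respectively; $K_4-e$ is $K_4$ minus one edge; $2K_2$ is two disjoint edges; $P_2\cup P_3$ is the disjoint union of paths on 2 and 3 vertices. -}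

module Defs where

open import Data.Nat using (ℕ; zero; suc)
open import Data.Fin using (Fin; toℕ) renaming (zero to f0; suc to fs)
open import Data.Product using (Σ; ∃; ∃-syntax; _×_; _,_)
open import Data.Sum using (_⊎_)
open import Data.List using (List; []; _∷_)
open import Data.List.Membership.Propositional using (_∈_)
open import Relation.Nullary using (¬_)
open import Relation.Binary.PropositionalEquality using (_≡_)
open import Function.Bundles using (_⤖_; _⇔_; Bijection)
open import Level using (0ℓ)

record Graph : Set₁ where
  field
    size : ℕ
    Adj  : Fin size → Fin size → Set
open Graph public

fromEdges : (n : ℕ) → List (Fin n × Fin n) → Graph
fromEdges n es = record { size = n ; Adj = λ u v → ((u , v) ∈ es) ⊎ ((v , u) ∈ es) }

path : ℕ → Graph
path k = record { size = k ; Adj = λ i j → (toℕ i ≡ suc (toℕ j)) ⊎ (toℕ j ≡ suc (toℕ i)) }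

Subset : ℕ → Set₁
Subset n = Fin n → Set

module _ (G : Graph) where
  private V = Fin (size G)

  IsDominating : (Fin (size G) → Set) → Set
  IsDominating S = ∀ v → S v ⊎ (∃[ u ] (S u × Adj G u v))

  -- A partition of V into m nonempty blocks, encoded by a surjective
  -- block-assignment map; block i is { v | f v ≡ i }.
  IsPartition : (m : ℕ) → (Fin (size G) → Fin m) → Set
  IsPartition m f = ∀ i → ∃[ v ] (f v ≡ i)

  module _ {m : ℕ} (f : Fin (size G) → Fin m) where
    Block : Fin m → Fin (size G) → Set
    Block i v = f v ≡ i

    -- Blocks i and j form a coalition (they are disjoint iff i ≠ j).
    Coalition : Fin m → Fin m → Set
    Coalition i j = ¬ (i ≡ j) × ¬ IsDominating (Block i) × ¬ IsDominating (Block j)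
                    × IsDominating (λ v → Block i v ⊎ Block j v)

    IsSingletonBlock : Fin m → Set
    IsSingletonBlock i = ∃[ v ] (∀ u → (Block i u ⇔ (u ≡ v)))

    IsCoalitionPartition : Set
    IsCoalitionPartition = IsPartition m f ×
      (∀ i → (IsDominating (Block i) × IsSingletonBlock i)
           ⊎ (¬ IsDominating (Block i) × ∃[ j ] Coalition i j))

    coalitionGraph : Graph
    coalitionGraph = record { size = m ; Adj = Coalition }

_≅_ : Graph → Graph → Set
G ≅ H = Σ (Fin (size G) ⤖ Fin (size H)) λ b →
          ∀ x y → (Adj G x y ⇔ Adj H (Bijection.to b x) (Bijection.to b y))

Defines : Graph → Graph → Set
Defines G H = ∃[ m ] Σ (Fin (size G) → Fin m) λ f →
                IsCoalitionPartition G f × (coalitionGraph G f ≅ H)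

v0 : ∀ {n} → Fin (suc n)
v0 = f0
v1 : ∀ {n} → Fin (suc (suc n))
v1 = fs f0
v2 : ∀ {n} → Fin (suc (suc (suc n)))
v2 = fs (fs f0)
v3 : ∀ {n} → Fin (suc (suc (suc (suc n))))
v3 = fs (fs (fs f0))
v4 : ∀ {n} → Fin (suc (suc (suc (suc (suc n)))))
v4 = fs (fs (fs (fs f0)))
v5 : ∀ {n} → Fin (suc (suc (suc (suc (suc (suc n))))))
v5 = fs (fs (fs (fs (fs f0))))

P3 K3 K13 2K2 P4 C4 F1 K4-e P2∪P3 F2 B1 P5 S21 S22 : Graph
P3    = fromEdges 3 ((v0 , v1) ∷ (v1 , v2) ∷ [])
K3    = fromEdges 3 ((v0 , v1) ∷ (v1 , v2) ∷ (v0 , v2) ∷ [])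
K13   = fromEdges 4 ((v0 , v1) ∷ (v0 , v2) ∷ (v0 , v3) ∷ [])
2K2   = fromEdges 4 ((v0 , v1) ∷ (v2 , v3) ∷ [])
P4    = fromEdges 4 ((v0 , v1) ∷ (v1 , v2) ∷ (v2 , v3) ∷ [])
C4    = fromEdges 4 ((v0 , v1) ∷ (v1 , v2) ∷ (v2 , v3) ∷ (v3 , v0) ∷ [])
F1    = fromEdges 4 ((v0 , v1) ∷ (v1 , v2) ∷ (v0 , v2) ∷ (v2 , v3) ∷ [])
K4-e  = fromEdges 4 ((v0 , v1) ∷ (v0 , v2) ∷ (v0 , v3) ∷ (v1 , v2) ∷ (v1 , v3) ∷ [])
P2∪P3 = fromEdges 5 ((v0 , v1) ∷ (v2 , v3) ∷ (v3 , v4) ∷ [])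
F2    = fromEdges 5 ((v0 , v1) ∷ (v1 , v2) ∷ (v2 , v3) ∷ (v3 , v0) ∷ (v0 , v4) ∷ [])
-- bull: triangle 0,1,2 with pendants 0-3 and 1-4
B1    = fromEdges 5 ((v0 , v1) ∷ (v1 , v2) ∷ (v0 , v2) ∷ (v0 , v3) ∷ (v1 , v4) ∷ [])
P5    = fromEdges 5 ((v0 , v1) ∷ (v1 , v2) ∷ (v2 , v3) ∷ (v3 , v4) ∷ [])
-- double star S(2,1): centres 0,1; leaves 2,3 at 0; leaf 4 at 1
S21   = fromEdges 5 ((v0 , v1) ∷ (v0 , v2) ∷ (v0 , v3) ∷ (v1 , v4) ∷ [])
-- double star S(2,2): centres 0,1; leaves 2,3 at 0; leaves 4,5 at 1
S22   = fromEdges 6 ((v0 , v1) ∷ (v0 , v2) ∷ (v0 , v3) ∷ (v1 , v4) ∷ (v1 , v5) ∷ [])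

forbiddenGraphs : List Graph
forbiddenGraphs = P3 ∷ K3 ∷ K13 ∷ 2K2 ∷ P4 ∷ C4 ∷ F1 ∷ K4-e ∷ P2∪P3 ∷ F2 ∷ B1 ∷ P5 ∷ S21 ∷ S22 ∷ []

-- For k ≤ 3 the path P_k has a universal vertex c. The block of any coalition
-- partition that contains c is then a dominating set, and a dominating set
-- forms a coalition with nothing, so it is an isolated vertex of the
-- coalition graph. Every one of the listed graphs has minimum degree at least
-- one, so none of them is a coalition graph of P_k.
module Submission where

open import Defs
open import Data.Nat using (ℕ; suc; _≤_; s≤s)
open import Data.Fin using (Fin; _≟_) renaming (zero to f0; suc to fs)
open import Data.Fin.Properties using (all?)
open import Data.Product using (∃-syntax; _×_; _,_; proj₁; proj₂)
open import Data.Sum using (_⊎_; inj₁; inj₂) renaming (map to ⊎-map)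
open import Data.List using (List; _∷_)
open import Data.List.Relation.Unary.Any using (Any; here; there; any?)
open import Data.List.Relation.Unary.All using (All; []; _∷_) renaming (map to All-map)
open import Relation.Nullary using (¬_)
open import Relation.Nullary.Decidable using (True; toWitness; _⊎-dec_)
open import Relation.Binary.PropositionalEquality using (_≡_; refl; subst; sym)
open import Function.Bundles using (Bijection; Equivalence)

IsUniversal : (G : Graph) → Fin (size G) → Set
IsUniversal G c = ∀ v → v ≡ c ⊎ Adj G c v

HasNoIsolatedVertex : Graph → Set
HasNoIsolatedVertex G = ∀ x → ∃[ y ] Adj G x y

module _ (G : Graph) {m : ℕ} (f : Fin (size G) → Fin m) where

  universal⇒block-dominating : ∀ {c} → IsUniversal G c →
                               IsDominating G (Block G f (f c))
  universal⇒block-dominating {c} univ v with univ v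
  ... | inj₁ refl = inj₁ refl
  ... | inj₂ c~v  = inj₂ (c , refl , c~v)

  dominating-block-isolated : ∀ {i} → IsDominating G (Block G f i) →
                              ∀ j → ¬ Adj (coalitionGraph G f) i j
  dominating-block-isolated dom j (_ , ¬dom , _) = ¬dom dom

≅-reflects-noIsolatedVertex : ∀ {G H} → G ≅ H →
                              HasNoIsolatedVertex H → HasNoIsolatedVertex G
≅-reflects-noIsolatedVertex {G} {H} (b , adj⇔) noIso x =
  w , Equivalence.from (adj⇔ x w) (subst (Adj H (to x)) (sym to-w≡y) x~y)
  where
  open Bijection b using (to; strictlySurjective)
  y   = proj₁ (noIso (to x))
  x~y = proj₂ (noIso (to x))
  w      = proj₁ (strictlySurjective y)
  to-w≡y = proj₂ (strictlySurjective y)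

universal⇒¬Defines : ∀ {G H c} → IsUniversal G c →
                     HasNoIsolatedVertex H → ¬ Defines G H
universal⇒¬Defines {G} {c = c} univ noIso (_ , f , _ , iso)
  with ≅-reflects-noIsolatedVertex iso noIso (f c)
... | j , c~j = dominating-block-isolated G f (universal⇒block-dominating G f univ) j c~j

path-universal : ∀ k → 1 ≤ k → k ≤ 3 → ∃[ c ] IsUniversal (path k) c
path-universal 1 _ _ = f0 , λ { f0 → inj₁ refl }
path-universal 2 _ _ = f0 , λ { f0 → inj₁ refl ; (fs f0) → inj₂ (inj₂ refl) }
path-universal 3 _ _ = fs f0 ,
  λ { f0 → inj₂ (inj₁ refl) ; (fs f0) → inj₁ refl ; (fs (fs f0)) → inj₂ (inj₂ refl) }
path-universal (suc (suc (suc (suc _)))) _ (s≤s (s≤s (s≤s ())))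

IsEndpoint : ∀ {n} → Fin n → Fin n × Fin n → Set
IsEndpoint v (a , b) = a ≡ v ⊎ b ≡ v

endpoint⇒neighbour : ∀ {n} (es : List (Fin n × Fin n)) {v} →
                     Any (IsEndpoint v) es → ∃[ u ] Adj (fromEdges n es) v u
endpoint⇒neighbour (_ ∷ _)  (here (inj₁ refl)) = _ , inj₁ (here refl)
endpoint⇒neighbour (_ ∷ _)  (here (inj₂ refl)) = _ , inj₂ (here refl)
endpoint⇒neighbour (_ ∷ es) (there p) with endpoint⇒neighbour es p
... | u , v~u = u , ⊎-map there there v~u

-- For a concrete edge list the implicit decision witness reduces to tt and
-- is filled in by eta, so the check is done by evaluation.
fromEdges-noIsolatedVertex :
  ∀ n es → {covers : True (all? λ v → any? (λ (a , b) → (a ≟ v) ⊎-dec (b ≟ v)) es)} →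
  HasNoIsolatedVertex (fromEdges n es)
fromEdges-noIsolatedVertex n es {covers} v = endpoint⇒neighbour es (toWitness covers v)

forbidden-noIsolatedVertex : All HasNoIsolatedVertex forbiddenGraphs
forbidden-noIsolatedVertex =
  fromEdges-noIsolatedVertex _ _ ∷ fromEdges-noIsolatedVertex _ _ ∷
  fromEdges-noIsolatedVertex _ _ ∷ fromEdges-noIsolatedVertex _ _ ∷
  fromEdges-noIsolatedVertex _ _ ∷ fromEdges-noIsolatedVertex _ _ ∷
  fromEdges-noIsolatedVertex _ _ ∷ fromEdges-noIsolatedVertex _ _ ∷
  fromEdges-noIsolatedVertex _ _ ∷ fromEdges-noIsolatedVertex _ _ ∷
  fromEdges-noIsolatedVertex _ _ ∷ fromEdges-noIsolatedVertex _ _ ∷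
  fromEdges-noIsolatedVertex _ _ ∷ fromEdges-noIsolatedVertex _ _ ∷ []

corollary4 : (k : ℕ) → 1 ≤ k → k ≤ 3 → All (λ H → ¬ Defines (path k) H) forbiddenGraphs
corollary4 k 1≤k k≤3 = All-map (universal⇒¬Defines univ) forbidden-noIsolatedVertex
  where
  univ : IsUniversal (path k) (proj₁ (path-universal k 1≤k k≤3))
  univ = proj₂ (path-universal k 1≤k k≤3)
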